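{- Let $G$ be a finite abelian group of odd order. Then $G$ contains no nontrivial sum set.
   Context: Let $G$ be a finite group of order $v$ and $S \subseteq G$ with $|S| = k$. For $a \in G$, the number of ways to write $a$ as a product in $S$ is the number of ordered pairs $(x,y) \in S\times S$ with $xy = a$. $S$ is a $(v,k,\mu)$ sum set if every nonidentity element of $G$ can be written as a product in $S$ in exactly $\mu$ ways. The trivial sum sets are $\varnothing$, $G$, the singletons $\{g\}$ with $g^2 = 1$, and their complements $G \setminus \{g\}$ with $g^2=1$; a sum set is nontrivial if it is not one of these. -}

module Defs where

open import Level using (Level; _⊔_; suc)
open import Algebra.Bundles using (AbelianGroup)
open import Data.Nat using (ℕ)
open import Data.Fin using (Fin)
open import Data.Fin.Subset using (Subset; _∈_; ⊥; ⊤; ⁅_⁆; ∁)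
open import Data.Fin.Subset.Properties using (_∈?_)
open import Data.List using (List; length; filter; cartesianProduct; allFin)
open import Data.Product using (Σ; ∃; _×_; _,_)
open import Data.Sum using (_⊎_)
open import Relation.Nullary using (¬_)
open import Relation.Nullary.Decidable using (_×-dec_)
open import Relation.Binary using (Decidable)
open import Relation.Binary.PropositionalEquality using (_≡_)

record FiniteAbelianGroup (c ℓ : Level) : Set (Level.suc (c ⊔ ℓ)) where
  field
    abGroup   : AbelianGroup c ℓ
  open AbelianGroup abGroup public
  field
    _≟_       : Decidable _≈_
    order     : ℕ
    enum      : Fin order → Carrier
    enum-inj  : ∀ {i j} → enum i ≈ enum j → i ≡ j
    enum-surj : ∀ x → ∃ λ i → enum i ≈ x

module _ {c ℓ : Level} (G : FiniteAbelianGroup c ℓ) where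
  open FiniteAbelianGroup G

  -- Subsets of G are represented by subsets of the index set Fin order
  -- (via the bijection enum).

  reps : Subset order → Carrier → ℕ
  reps S a = length (filter
    (λ p → let i = Data.Product.proj₁ p ; j = Data.Product.proj₂ p in
       (i ∈? S) ×-dec ((j ∈? S) ×-dec ((enum i ∙ enum j) ≟ a)))
    (cartesianProduct (allFin order) (allFin order)))

  IsSumSet : Subset order → ℕ → Set (c ⊔ ℓ)
  IsSumSet S μ = ∀ a → ¬ (a ≈ ε) → reps S a ≡ μ

  IsTrivial : Subset order → Set ℓ
  IsTrivial S =
    S ≡ ⊥ ⊎ S ≡ ⊤
    ⊎ (∃ λ i → (enum i ∙ enum i ≈ ε) × S ≡ ⁅ i ⁆)
    ⊎ (∃ λ i → (enum i ∙ enum i ≈ ε) × S ≡ ∁ ⁅ i ⁆)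

-- Counting the pairs (x , y) ∈ S × S with x y = a, the pairs with x ≠ y cancel in swapped
-- couples since G is abelian, so reps S a ≡ #{x ∈ S ∣ x² = a} (mod 2).  In a group of odd
-- order x ↦ x g is a fixed-point-free involution whenever g² = 1 ≠ g, so G has no involutions
-- and squaring is injective; hence reps S (y²) ≡ [y ∈ S] (mod 2).  For a sum set the left-hand
-- side is the same for every y ≠ 1, so S ∖ {1} is either empty or all of G ∖ {1}.
module Submission where

open import Defs
open import Level using (Level)
open import Data.Nat using (ℕ)
open import Data.Nat.Divisibility using (_∣_)
open import Data.Fin.Subset using (Subset)
open import Relation.Nullary using (¬_)

open import Data.Nat using (zero; suc; _+_; _*_)
open import Data.Nat.Properties using (+-0-commutativeMonoid; even≢odd)
open import Data.Nat.Divisibility using (m∣m*n)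
open import Data.Nat.Tactic.RingSolver using (solve-∀)
open import Data.Fin using (Fin) renaming (_≟_ to _≟ᶠ_)
open import Data.Fin.Properties using (any?) renaming (suc-injective to Fin-suc-injective)
open import Data.Fin.Subset using (_∈_; _⊆_; ⊥; ⊤; ⁅_⁆; ∁)
open import Data.Fin.Subset.Properties
  using (_∈?_; ⊆-antisym; ∈⊤; ∉⊥; x∈⁅x⁆; x∈⁅y⁆⇒x≡y; x∉p⇒x∈∁p; x∈∁p⇒x∉p)
open import Data.List using (length; filter; cartesianProduct; tabulate; map; _++_)
open import Data.List.Properties using (filter-++; length-++; map-tabulate)
open import Data.Product using (∃; _×_; _,_; proj₁; proj₂; map₂)
open import Data.Sum using (_⊎_; inj₁; inj₂)
import Data.Sum as Sum
open import Function using (_∘_; _⇔_; mk⇔; Equivalence)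
open import Relation.Nullary using (Dec; yes; no; ¬?; contradiction)
open import Relation.Nullary.Decidable using (_×-dec_)
open import Relation.Unary using (Pred; Decidable)
open import Relation.Binary.PropositionalEquality
  using (_≡_; _≢_; refl; sym; trans; cong; cong₂; subst; module ≡-Reasoning)
import Relation.Binary.Reasoning.Setoid
open import Algebra.Properties.CommutativeMonoid.Sum +-0-commutativeMonoid
  using (sum-syntax; sum-cong-≗; sum-replicate-zero; ∑-distrib-+)

𝟙 : ∀ {a} {A : Set a} → Dec A → ℕ
𝟙 (yes _) = 1
𝟙 (no _)  = 0

𝟙-yes : ∀ {a} {A : Set a} (A? : Dec A) → A → 𝟙 A? ≡ 1
𝟙-yes (yes _) _ = refl
𝟙-yes (no ¬a) a = contradiction a ¬a

𝟙-no : ∀ {a} {A : Set a} (A? : Dec A) → ¬ A → 𝟙 A? ≡ 0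
𝟙-no (yes a) ¬a = contradiction a ¬a
𝟙-no (no _)  _  = refl

𝟙-cong : ∀ {a b} {A : Set a} {B : Set b} → A ⇔ B → (A? : Dec A) (B? : Dec B) → 𝟙 A? ≡ 𝟙 B?
𝟙-cong A⇔B (yes a) B? = sym (𝟙-yes B? (Equivalence.to A⇔B a))
𝟙-cong A⇔B (no ¬a) B? = sym (𝟙-no B? (¬a ∘ Equivalence.from A⇔B))

𝟙-parity : ∀ {a b} {A : Set a} {B : Set b} (A? : Dec A) (B? : Dec B) {k l : ℕ} →
           𝟙 A? + 2 * k ≡ 𝟙 B? + 2 * l → A → B
𝟙-parity (yes _) (yes b)     _  _ = b
𝟙-parity (yes _) (no _) {k} {l} eq _ = contradiction (sym eq) (even≢odd l k)
𝟙-parity (no ¬a) _           _  a = contradiction a ¬a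

∑𝟙-none : ∀ {p} {n : ℕ} {P : Pred (Fin n) p} (P? : Decidable P) →
          (∀ i → ¬ P i) → ∑[ i < n ] 𝟙 (P? i) ≡ 0
∑𝟙-none {n = n} P? ¬P = trans (sum-cong-≗ (λ i → 𝟙-no (P? i) (¬P i))) (sum-replicate-zero n)

∑𝟙-unique : ∀ {p} {n : ℕ} {P : Pred (Fin n) p} (P? : Decidable P) {x : Fin n} →
            P x → (∀ {i} → P i → i ≡ x) → ∑[ i < n ] 𝟙 (P? i) ≡ 1
∑𝟙-unique P? {Fin.zero} Px unique =
  cong₂ _+_ (𝟙-yes (P? Fin.zero) Px)
            (∑𝟙-none (P? ∘ Fin.suc) λ _ P[1+i] → contradiction (unique P[1+i]) λ ())
∑𝟙-unique P? {Fin.suc x} Px unique =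
  cong₂ _+_ (𝟙-no (P? Fin.zero) λ P0 → contradiction (unique P0) λ ())
            (∑𝟙-unique (P? ∘ Fin.suc) Px (Fin-suc-injective ∘ unique))

∑1≡n : ∀ n → ∑[ i < n ] 1 ≡ n
∑1≡n zero    = refl
∑1≡n (suc n) = cong suc (∑1≡n n)

module _ {a p} {A : Set a} {P : Pred A p} (P? : Decidable P) where

  length-filter-tabulate : ∀ n (f : Fin n → A) →
    length (filter P? (tabulate f)) ≡ ∑[ i < n ] 𝟙 (P? (f i))
  length-filter-tabulate zero    f = refl
  length-filter-tabulate (suc n) f with P? (f Fin.zero)
  ... | yes _ = cong suc (length-filter-tabulate n (f ∘ Fin.suc))
  ... | no  _ = length-filter-tabulate n (f ∘ Fin.suc)

module _ {a b p} {A : Set a} {B : Set b} {P : Pred (A × B) p} (P? : Decidable P) where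

  length-filter-cartesianProduct : ∀ m n (f : Fin m → A) (g : Fin n → B) →
    length (filter P? (cartesianProduct (tabulate f) (tabulate g)))
      ≡ ∑[ i < m ] ∑[ j < n ] 𝟙 (P? (f i , g j))
  length-filter-cartesianProduct zero    n f g = refl
  length-filter-cartesianProduct (suc m) n f g = begin
    length (filter P? (row ++ rest))                   ≡⟨ cong length (filter-++ P? row rest) ⟩
    length (filter P? row ++ filter P? rest)           ≡⟨ length-++ (filter P? row) ⟩
    length (filter P? row) + length (filter P? rest)
      ≡⟨ cong₂ _+_ (trans (cong (length ∘ filter P?) (map-tabulate g (f Fin.zero ,_)))
                          (length-filter-tabulate P? n _))
                   (length-filter-cartesianProduct m n (f ∘ Fin.suc) g) ⟩
    ∑[ i < suc m ] ∑[ j < n ] 𝟙 (P? (f i , g j))       ∎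
    where
    open ≡-Reasoning
    row  = map (f Fin.zero ,_) (tabulate g)
    rest = cartesianProduct (tabulate (f ∘ Fin.suc)) (tabulate g)

∑∑-symmetric : ∀ n (f : Fin n → Fin n → ℕ) → (∀ i j → f i j ≡ f j i) →
  ∃ λ k → ∑[ i < n ] ∑[ j < n ] f i j ≡ ∑[ i < n ] f i i + 2 * k
∑∑-symmetric zero    f symm = 0 , refl
∑∑-symmetric (suc n) f symm with ∑∑-symmetric n (λ i j → f (Fin.suc i) (Fin.suc j)) (λ i j → symm _ _)
... | k , inner = r + k , (begin
  (f₀₀ + r) + ∑[ i < n ] (f (Fin.suc i) Fin.zero + ∑[ j < n ] f (Fin.suc i) (Fin.suc j))
    ≡⟨ cong (f₀₀ + r +_) (∑-distrib-+ (λ i → f (Fin.suc i) Fin.zero) _) ⟩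
  (f₀₀ + r) + (∑[ i < n ] f (Fin.suc i) Fin.zero + ∑[ i < n ] ∑[ j < n ] f (Fin.suc i) (Fin.suc j))
    ≡⟨ cong₂ (λ c t → (f₀₀ + r) + (c + t)) (sum-cong-≗ (λ i → symm (Fin.suc i) Fin.zero)) inner ⟩
  (f₀₀ + r) + (r + (d + 2 * k))
    ≡⟨ rearrange f₀₀ r d k ⟩
  (f₀₀ + d) + 2 * (r + k) ∎)
  where
  open ≡-Reasoning
  f₀₀ = f Fin.zero Fin.zero
  r   = ∑[ j < n ] f Fin.zero (Fin.suc j)
  d   = ∑[ i < n ] f (Fin.suc i) (Fin.suc i)
  rearrange : ∀ a r d k → (a + r) + (r + (d + 2 * k)) ≡ (a + d) + 2 * (r + k)
  rearrange = solve-∀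

fixedPointFree-involution⇒even : ∀ {n} (σ : Fin n → Fin n) →
  (∀ i → σ (σ i) ≡ i) → (∀ i → σ i ≢ i) → 2 ∣ n
fixedPointFree-involution⇒even {n} σ involutive fixedPointFree =
  subst (2 ∣_) n≡2k (m∣m*n k)
  where
  graph : Fin n → Fin n → ℕ
  graph i j = 𝟙 (j ≟ᶠ σ i)
  graph-symmetric : ∀ i j → graph i j ≡ graph j i
  graph-symmetric i j = 𝟙-cong (mk⇔ flip flip) (j ≟ᶠ σ i) (i ≟ᶠ σ j)
    where flip : ∀ {i j} → j ≡ σ i → i ≡ σ j
          flip {i} refl = sym (involutive i)
  parity = ∑∑-symmetric n graph graph-symmetric
  k = proj₁ parity
  n≡2k : 2 * k ≡ n
  n≡2k = begin
    2 * k                                   ≡⟨ cong (_+ 2 * k) (∑𝟙-none (λ i → i ≟ᶠ σ i) (λ i → fixedPointFree i ∘ sym)) ⟨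
    ∑[ i < n ] graph i i + 2 * k            ≡⟨ proj₂ parity ⟨
    ∑[ i < n ] ∑[ j < n ] graph i j         ≡⟨ sum-cong-≗ (λ i → ∑𝟙-unique (_≟ᶠ σ i) refl (λ eq → eq)) ⟩
    ∑[ i < n ] 1                            ≡⟨ ∑1≡n n ⟩
    n                                       ∎
    where open ≡-Reasoning

module _ {n : ℕ} (z : Fin n) where

  ⊆-by-cases : ∀ {S T : Subset n} → (z ∈ S → z ∈ T) → (∀ {i} → i ≢ z → i ∈ S → i ∈ T) → S ⊆ T
  ⊆-by-cases at-z off-z {i} i∈S with i ≟ᶠ z
  ... | yes refl = at-z i∈S
  ... | no  i≢z  = off-z i≢z i∈S

  constant-off-point : (S : Subset n) → (∀ {x y} → x ≢ z → y ≢ z → x ∈ S → y ∈ S) →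
    S ≡ ⊥ ⊎ S ≡ ⊤ ⊎ S ≡ ⁅ z ⁆ ⊎ S ≡ ∁ ⁅ z ⁆
  constant-off-point S constant with any? (λ x → ¬? (x ≟ᶠ z) ×-dec x ∈? S) | z ∈? S
  ... | yes (x , x≢z , x∈S) | yes z∈S =
    inj₂ (inj₁ (⊆-antisym (λ _ → ∈⊤) (⊆-by-cases (λ _ → z∈S) λ i≢z _ → constant x≢z i≢z x∈S)))
  ... | yes (x , x≢z , x∈S) | no  z∉S = inj₂ (inj₂ (inj₂ (⊆-antisym
    (⊆-by-cases (λ z∈S → contradiction z∈S z∉S) λ i≢z _ → x∉p⇒x∈∁p (i≢z ∘ x∈⁅y⁆⇒x≡y z))
    (⊆-by-cases (λ z∈∁z → contradiction (x∈⁅x⁆ z) (x∈∁p⇒x∉p z∈∁z)) λ i≢z _ → constant x≢z i≢z x∈S))))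
  ... | no  none | yes z∈S = inj₂ (inj₂ (inj₁ (⊆-antisym
    (⊆-by-cases (λ _ → x∈⁅x⁆ z) λ i≢z i∈S → contradiction (_ , i≢z , i∈S) none)
    (⊆-by-cases (λ _ → z∈S) λ i≢z i∈z → contradiction (x∈⁅y⁆⇒x≡y z i∈z) i≢z))))
  ... | no  none | no  z∉S = inj₁ (⊆-antisym
    (⊆-by-cases (λ z∈S → contradiction z∈S z∉S) λ i≢z i∈S → contradiction (_ , i≢z , i∈S) none)
    (λ i∈⊥ → contradiction i∈⊥ ∉⊥))

module _ {c ℓ : Level} (G : FiniteAbelianGroup c ℓ) where
  open FiniteAbelianGroup G
    hiding (sym; trans; refl) renaming (_≟_ to _≟ᴳ_)
  open FiniteAbelianGroup G
    using () renaming (sym to ≈-sym; trans to ≈-trans; refl to ≈-refl)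
  open import Algebra.Properties.Group group using (x∙y⁻¹≈ε⇒x≈y; identityʳ-unique)
  open import Algebra.Properties.CommutativeSemigroup commutativeSemigroup using (interchange)
  module ≈-Reasoning = Relation.Binary.Reasoning.Setoid setoid

  enum⁻¹ : Carrier → Fin order
  enum⁻¹ x = proj₁ (enum-surj x)

  enum-enum⁻¹ : ∀ x → enum (enum⁻¹ x) ≈ x
  enum-enum⁻¹ x = proj₂ (enum-surj x)

  product-in? : (S : Subset order) (a : Carrier) (i j : Fin order) →
                Dec (i ∈ S × j ∈ S × enum i ∙ enum j ≈ a)
  product-in? S a i j = (i ∈? S) ×-dec ((j ∈? S) ×-dec ((enum i ∙ enum j) ≟ᴳ a))

  reps≡∑∑ : ∀ S a → reps G S a ≡ ∑[ i < order ] ∑[ j < order ] 𝟙 (product-in? S a i j)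
  reps≡∑∑ S a = length-filter-cartesianProduct (λ (i , j) → product-in? S a i j) order order _ _

  reps-parity : ∀ S a → ∃ λ k → reps G S a ≡ ∑[ i < order ] 𝟙 (product-in? S a i i) + 2 * k
  reps-parity S a = map₂ (trans (reps≡∑∑ S a)) (∑∑-symmetric order _ λ i j →
    𝟙-cong (mk⇔ swap swap) (product-in? S a i j) (product-in? S a j i))
    where
    swap : ∀ {i j} → i ∈ S × j ∈ S × enum i ∙ enum j ≈ a → j ∈ S × i ∈ S × enum j ∙ enum i ≈ a
    swap (i∈S , j∈S , ij≈a) = j∈S , i∈S , ≈-trans (comm _ _) ij≈a

  module _ (odd : ¬ 2 ∣ order) where

    involution-free : ∀ {g} → g ∙ g ≈ ε → g ≈ ε
    involution-free {g} g²≈ε with g ≟ᴳ ε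
    ... | yes g≈ε = g≈ε
    ... | no  g≉ε = contradiction (fixedPointFree-involution⇒even σ involutive fixedPointFree) odd
      where
      σ : Fin order → Fin order
      σ i = enum⁻¹ (enum i ∙ g)
      involutive : ∀ i → σ (σ i) ≡ i
      involutive i = enum-inj (begin
        enum (σ (σ i))      ≈⟨ enum-enum⁻¹ _ ⟩
        enum (σ i) ∙ g      ≈⟨ ∙-congʳ (enum-enum⁻¹ _) ⟩
        (enum i ∙ g) ∙ g    ≈⟨ assoc _ g g ⟩
        enum i ∙ (g ∙ g)    ≈⟨ ∙-congˡ g²≈ε ⟩
        enum i ∙ ε          ≈⟨ identityʳ _ ⟩
        enum i              ∎)
        where open ≈-Reasoning
      fixedPointFree : ∀ i → σ i ≢ i
      fixedPointFree i σi≡i = g≉ε (identityʳ-unique (enum i) g (begin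
        enum i ∙ g          ≈⟨ enum-enum⁻¹ _ ⟨
        enum (σ i)          ≡⟨ cong enum σi≡i ⟩
        enum i              ∎))
        where open ≈-Reasoning

    square-injective : ∀ {x y} → x ∙ x ≈ y ∙ y → x ≈ y
    square-injective {x} {y} x²≈y² = x∙y⁻¹≈ε⇒x≈y x y (involution-free (begin
      (x ∙ y ⁻¹) ∙ (x ∙ y ⁻¹)   ≈⟨ interchange x (y ⁻¹) x (y ⁻¹) ⟩
      (x ∙ x) ∙ (y ⁻¹ ∙ y ⁻¹)   ≈⟨ ∙-congʳ x²≈y² ⟩
      (y ∙ y) ∙ (y ⁻¹ ∙ y ⁻¹)   ≈⟨ interchange y y (y ⁻¹) (y ⁻¹) ⟩
      (y ∙ y ⁻¹) ∙ (y ∙ y ⁻¹)   ≈⟨ ∙-cong (inverseʳ y) (inverseʳ y) ⟩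
      ε ∙ ε                     ≈⟨ identityˡ ε ⟩
      ε                         ∎))
      where open ≈-Reasoning

    ∑-diagonal-at-square : ∀ S y →
      ∑[ i < order ] 𝟙 (product-in? S (enum y ∙ enum y) i i) ≡ 𝟙 (y ∈? S)
    ∑-diagonal-at-square S y with y ∈? S
    ... | yes y∈S = ∑𝟙-unique (λ i → product-in? S _ i i) (y∈S , y∈S , ≈-refl)
                      λ (_ , _ , i²≈y²) → enum-inj (square-injective i²≈y²)
    ... | no  y∉S = ∑𝟙-none (λ i → product-in? S _ i i)
                      λ i (i∈S , _ , i²≈y²) → y∉S (subst (_∈ S) (enum-inj (square-injective i²≈y²)) i∈S)

    reps-square-parity : ∀ S y → ∃ λ k → reps G S (enum y ∙ enum y) ≡ 𝟙 (y ∈? S) + 2 * k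
    reps-square-parity S y =
      map₂ (λ eq → trans eq (cong (_+ _) (∑-diagonal-at-square S y))) (reps-parity S (enum y ∙ enum y))

    sumSet-constant-off-ε : ∀ {S μ} → IsSumSet G S μ →
      ∀ {x y} → x ≢ enum⁻¹ ε → y ≢ enum⁻¹ ε → x ∈ S → y ∈ S
    sumSet-constant-off-ε {S} {μ} sumSet {x} {y} x≢ε y≢ε
      with reps-square-parity S x | reps-square-parity S y
    ... | k , x-parity | l , y-parity = 𝟙-parity (x ∈? S) (y ∈? S) {k} {l} (begin
      𝟙 (x ∈? S) + 2 * k          ≡⟨ x-parity ⟨
      reps G S (enum x ∙ enum x)  ≡⟨ sumSet _ (square≉ε x≢ε) ⟩
      μ                           ≡⟨ sumSet _ (square≉ε y≢ε) ⟨
      reps G S (enum y ∙ enum y)  ≡⟨ y-parity ⟩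
      𝟙 (y ∈? S) + 2 * l          ∎)
      where
      open ≡-Reasoning
      square≉ε : ∀ {i} → i ≢ enum⁻¹ ε → ¬ enum i ∙ enum i ≈ ε
      square≉ε i≢ε i²≈ε = i≢ε (enum-inj (≈-trans (involution-free i²≈ε) (≈-sym (enum-enum⁻¹ ε))))

theorem3p2 : {c ℓ : Level} (G : FiniteAbelianGroup c ℓ) →
    ¬ (2 ∣ FiniteAbelianGroup.order G) →
    (S : Subset (FiniteAbelianGroup.order G)) (μ : ℕ) →
    IsSumSet G S μ → IsTrivial G S
theorem3p2 G odd S μ sumSet =
  Sum.map₂ (Sum.map₂ (Sum.map (λ eq → z , z²≈ε , eq) (λ eq → z , z²≈ε , eq)))
    (constant-off-point z S (sumSet-constant-off-ε G odd sumSet))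
  where
  open FiniteAbelianGroup G using (order; _≈_; _∙_; ε; enum; ∙-cong; identityˡ) renaming (trans to ≈-trans)
  z : Fin order
  z = enum⁻¹ G ε
  z²≈ε : enum z ∙ enum z ≈ ε
  z²≈ε = ≈-trans (∙-cong (enum-enum⁻¹ G ε) (enum-enum⁻¹ G ε)) (identityˡ ε)
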